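{- Let $G$ be a graph with vertex partition $V(G) = A \cup B$, where $B$ is an independent set. Let $F$ be a graph on $\ell$ vertices with $\ell \geq |A|$. Then $s(F,G) \leq 2^{\ell} (|B|+1)^{e(F)+2\ell}$.
   Context: All graphs are finite and simple. A subdivision of a graph $F$ is a graph obtained from $F$ by replacing its edges with internally vertex-disjoint paths between their endpoints. Two subgraphs $H,H'$ of $G$ are distinguishable if $V(H)\neq V(H')$. $s(F,G)$ denotes the maximum size of a collection of pairwise distinguishable subgraphs of $G$ each of which is a subdivision of $F$. $e(F)$ is the number of edges of $F$. -}

module Defs where

open import Data.Nat using (ℕ; zero; suc; _+_; _<ᵇ_)
open import Data.Fin using (Fin; toℕ) renaming (zero to fzero; suc to fsuc)
open import Data.Bool using (Bool; true; false; if_then_else_; _∧_)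
open import Data.List using (List; []; _∷_; _++_)
open import Data.List.Membership.Propositional using (_∈_; _∉_)
open import Data.List.Relation.Unary.Unique.Propositional using (Unique)
open import Data.Product using (_×_; ∃; ∃₂)
open import Data.Sum using (_⊎_)
open import Data.Unit using (⊤)
open import Relation.Nullary using (¬_)
open import Relation.Binary.PropositionalEquality using (_≡_)

record Graph (n : ℕ) : Set where
  field
    adj    : Fin n → Fin n → Bool
    sym    : ∀ i j → adj i j ≡ adj j i
    irrefl : ∀ i → adj i i ≡ false
open Graph public

countB : ∀ {n} → (Fin n → Bool) → ℕ
countB {zero}  p = 0
countB {suc n} p = (if p fzero then 1 else 0) + countB (λ i → p (fsuc i))

sumFin : ∀ {n} → (Fin n → ℕ) → ℕ
sumFin {zero}  f = 0
sumFin {suc n} f = f fzero + sumFin (λ i → f (fsuc i))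

-- each edge {i,j} of a graph is represented once, by the pair (i,j) with i < j
isEdge : ∀ {n} → Graph n → Fin n → Fin n → Bool
isEdge G i j = (toℕ i <ᵇ toℕ j) ∧ adj G i j

edges : ∀ {n} → Graph n → ℕ
edges G = sumFin (λ i → countB (isEdge G i))

Chain : ∀ {n} → Graph n → List (Fin n) → Set
Chain G []            = ⊤
Chain G (x ∷ [])      = ⊤
Chain G (x ∷ y ∷ zs)  = (adj G x y ≡ true) × Chain G (y ∷ zs)

-- A subgraph of G which is a subdivision of F: branch vertices (injective image of V(F)),
-- and for each edge ij of F a path branch i, inner i j, branch j in G; the paths are
-- internally vertex-disjoint and their inner vertices avoid all branch vertices.
record Subdivision {ℓ n : ℕ} (F : Graph ℓ) (G : Graph n) : Set where
  field
    branch         : Fin ℓ → Fin n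
    branch-inj     : ∀ i j → branch i ≡ branch j → i ≡ j
    inner          : Fin ℓ → Fin ℓ → List (Fin n)
    isPath         : ∀ i j → isEdge F i j ≡ true →
                     Chain G (branch i ∷ (inner i j ++ (branch j ∷ [])))
    inner-unique   : ∀ i j → isEdge F i j ≡ true → Unique (inner i j)
    inner-avoids   : ∀ i j k → isEdge F i j ≡ true → branch k ∉ inner i j
    inner-disjoint : ∀ i j i' j' → isEdge F i j ≡ true → isEdge F i' j' ≡ true →
                     ¬ (i ≡ i' × j ≡ j') → ∀ v → v ∈ inner i j → v ∉ inner i' j'
open Subdivision public

_∈V_ : ∀ {ℓ n} {F : Graph ℓ} {G : Graph n} → Fin n → Subdivision F G → Set
_∈V_ {F = F} v H = (∃ λ k → branch H k ≡ v) ⊎ (∃₂ λ i j → (isEdge F i j ≡ true) × (v ∈ inner H i j))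

Distinguishable : ∀ {ℓ n} {F : Graph ℓ} {G : Graph n} → Subdivision F G → Subdivision F G → Set
Distinguishable {n = n} H H' = ¬ (∀ (v : Fin n) → ((v ∈V H) → (v ∈V H')) × ((v ∈V H') → (v ∈V H)))

-- Pairwise
-- distinguishable subdivisions H of F have pairwise different vertex sets,
-- so it suffices to count the possible vertex sets.  Each of them contains
-- at most e(F) + 2ℓ vertices of B: at most ℓ branch vertices, and along each
-- of the e(F) subdivided paths, B-vertices are separated by A-vertices (B is
-- independent), so every path has at most one more inner B-vertex than inner
-- A-vertex, while the inner A-vertices of different paths are distinct, so
-- there are at most |A| ≤ ℓ of them.  Finally a set S ⊆ V(G) with
-- |S ∩ B| ≤ K is determined by S ∩ A (2^|A| ≤ 2^ℓ choices) and S ∩ B, and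
-- there are at most (|B|+1)^K choices for the latter.
module Submission where

open import Defs hiding (sym)
open import Data.Nat using (ℕ; zero; suc; _+_; _*_; _^_; _≤_; z≤n; s≤s)
open import Data.Nat.Properties
  using (+-mono-≤; +-monoʳ-≤; *-monoˡ-≤; *-monoʳ-≤; ^-monoˡ-≤; ^-monoʳ-≤; ≤-refl; ≤-reflexive; ≤-trans;
         n≤1+n; m≤n+m; *-identityˡ; ^-zeroˡ; module ≤-Reasoning)
open import Data.Nat.Tactic.RingSolver using (solve-∀)
open import Data.Fin using (Fin; _↑ˡ_; _↑ʳ_; splitAt) renaming (zero to fzero; suc to fsuc)
open import Data.Fin.Properties
  using (injective⇒≤; any?; ↑ˡ-injective; ↑ʳ-injective; splitAt-↑ˡ; splitAt-↑ʳ) renaming (_≟_ to _≟ᶠ_)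
open import Data.Bool using (Bool; true; false; not; if_then_else_; _∧_)
open import Data.Bool.Properties using (T-≡) renaming (_≟_ to _≟ᵇ_)
open import Data.List using (List; []; _∷_; _++_; length; lookup; map; tabulate; concat; allFin; filterᵇ)
open import Data.List.Properties using (length-++; length-map; length-tabulate)
open import Data.List.Membership.Propositional using (_∈_)
open import Data.List.Membership.Propositional.Properties
  using (∈-lookup; ∈-allFin; ∈-filter⁺; ∈-filter⁻; ∈-concat⁺; ∈-concat⁻; ∈-++⁺ˡ; ∈-++⁺ʳ; ∈-map⁺)
open import Data.List.Membership.DecPropositional using () renaming (_∈?_ to member?)
open import Data.List.Relation.Unary.All as All using ()
open import Data.List.Relation.Unary.All.Properties as All using ()
open import Data.List.Relation.Unary.AllPairs using ([]; _∷_)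
open import Data.List.Relation.Unary.AllPairs.Properties as AllPairs using ()
open import Data.List.Relation.Unary.Any using (index)
open import Data.List.Relation.Unary.Any.Properties as Any using (lookup-index)
open import Data.List.Relation.Unary.Unique.Propositional using (Unique)
open import Data.List.Relation.Unary.Unique.Propositional.Properties using (filter⁺; allFin⁺; concat⁺)
open import Data.List.Relation.Binary.Subset.Propositional using (_⊆_)
open import Data.List.Relation.Binary.Disjoint.Propositional using (Disjoint)
open import Data.Product using (_×_; _,_; ∃; ∃-syntax; ∃₂; proj₁; proj₂)
open import Data.Sum using (inj₁; inj₂)
open import Data.Unit using (tt)
open import Function using (_∘_; Equivalence)
open import Relation.Binary.PropositionalEquality
open import Relation.Nullary using (¬_; Dec; yes; does; contradiction)
open import Relation.Nullary.Decidable using (T?; _×-dec_; _⊎-dec_; dec-true; decidable-stable)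

private variable
  A : Set
  n : ℕ

ind : Bool → ℕ
ind b = if b then 1 else 0

∧-true : ∀ {x y} → x ∧ y ≡ true → x ≡ true × y ≡ true
∧-true {true} {true} _ = refl , refl

does-true : ∀ {P : Set} (P? : Dec P) → does P? ≡ true → P
does-true (yes p) _ = p

lookup-injective : ∀ {xs : List A} → Unique xs → ∀ i j → lookup xs i ≡ lookup xs j → i ≡ j
lookup-injective (_  ∷ _) fzero    fzero    _  = refl
lookup-injective (x∉ ∷ _) fzero    (fsuc j) eq = contradiction eq (All.lookup x∉ (∈-lookup j))
lookup-injective (x∉ ∷ _) (fsuc i) fzero    eq = contradiction (sym eq) (All.lookup x∉ (∈-lookup i))
lookup-injective (_  ∷ u) (fsuc i) (fsuc j) eq = cong fsuc (lookup-injective u i j eq)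

-- Sending each position of xs to a position of the same element in ys is injective.
unique-⊆-length : ∀ {xs ys : List A} → Unique xs → xs ⊆ ys → length xs ≤ length ys
unique-⊆-length {xs = xs} {ys} u xs⊆ys = injective⇒≤ position-injective
  where
  position : Fin (length xs) → Fin (length ys)
  position i = index (xs⊆ys (∈-lookup i))
  position-correct : ∀ i → lookup xs i ≡ lookup ys (position i)
  position-correct i = lookup-index (xs⊆ys (∈-lookup i))
  position-injective : ∀ {i j} → position i ≡ position j → i ≡ j
  position-injective {i} {j} eq = lookup-injective u i j
    (trans (position-correct i) (trans (cong (lookup ys) eq) (sym (position-correct j))))

∈-filterᵇ⁺ : (p : A → Bool) {xs : List A} {v : A} → v ∈ xs → p v ≡ true → v ∈ filterᵇ p xs
∈-filterᵇ⁺ p m pv = ∈-filter⁺ (T? ∘ p) m (Equivalence.from T-≡ pv)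

∈-filterᵇ⁻ : (p : A → Bool) {xs : List A} {v : A} → v ∈ filterᵇ p xs → v ∈ xs × p v ≡ true
∈-filterᵇ⁻ p {xs} m with ∈-filter⁻ (T? ∘ p) {xs = xs} m
... | m' , pv = m' , Equivalence.to T-≡ pv

members : (Fin n → Bool) → List (Fin n)
members {n} p = filterᵇ p (allFin n)

length-filter-tabulate : ∀ (p : A → Bool) (f : Fin n → A) → length (filterᵇ p (tabulate f)) ≡ countB (p ∘ f)
length-filter-tabulate {n = zero}  p f = refl
length-filter-tabulate {n = suc n} p f with p (f fzero)
... | true  = cong suc (length-filter-tabulate p (f ∘ fsuc))
... | false = length-filter-tabulate p (f ∘ fsuc)

members-unique : (p : Fin n → Bool) → Unique (members p)
members-unique {n} p = filter⁺ (T? ∘ p) {allFin n} (allFin⁺ n)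

∈-members : (p : Fin n → Bool) → ∀ {v} → p v ≡ true → v ∈ members p
∈-members p = ∈-filterᵇ⁺ p (∈-allFin _)

members-∈ : (p : Fin n → Bool) → ∀ {v} → v ∈ members p → p v ≡ true
members-∈ {n} p = proj₂ ∘ ∈-filterᵇ⁻ p {xs = allFin n}

countB≤length : (p : Fin n → Bool) (L : List (Fin n)) → (∀ {v} → p v ≡ true → v ∈ L) → countB p ≤ length L
countB≤length p L covers = subst (_≤ length L) (length-filter-tabulate p (λ i → i))
  (unique-⊆-length (members-unique p) (covers ∘ members-∈ p))

length≤countB : (p : Fin n → Bool) (L : List (Fin n)) → Unique L → (∀ {v} → v ∈ L → p v ≡ true) → length L ≤ countB p
length≤countB p L u inside = subst (length L ≤_) (length-filter-tabulate p (λ i → i))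
  (unique-⊆-length u (∈-members p ∘ inside))

countB-as-sum : (p : Fin n → Bool) → countB p ≡ sumFin (ind ∘ p)
countB-as-sum {zero}  p = refl
countB-as-sum {suc n} p = cong (ind (p fzero) +_) (countB-as-sum (p ∘ fsuc))

⋃ : (Fin n → List A) → List A
⋃ g = concat (tabulate g)

∈-⋃⁺ : ∀ (g : Fin n → List A) i {v} → v ∈ g i → v ∈ ⋃ g
∈-⋃⁺ g i m = ∈-concat⁺ (Any.tabulate⁺ i m)

∈-⋃⁻ : ∀ (g : Fin n → List A) {v} → v ∈ ⋃ g → ∃ λ i → v ∈ g i
∈-⋃⁻ g m = Any.tabulate⁻ (∈-concat⁻ (tabulate g) m)

⋃-unique : ∀ (g : Fin n → List A) → (∀ i → Unique (g i)) → (∀ {i j} → i ≢ j → Disjoint (g i) (g j)) → Unique (⋃ g)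
⋃-unique g u d = concat⁺ (All.tabulate⁺ u) (AllPairs.tabulate⁺ d)

⋃-length : ∀ (f g : Fin n → List A) (c : Fin n → ℕ) → (∀ i → length (f i) ≤ c i + length (g i)) →
  length (⋃ f) ≤ sumFin c + length (⋃ g)
⋃-length {n = zero}  f g c bound = z≤n
⋃-length {n = suc n} f g c bound = begin
  length (f fzero ++ ⋃ (f ∘ fsuc))                                            ≡⟨ length-++ (f fzero) ⟩
  length (f fzero) + length (⋃ (f ∘ fsuc))                                    ≤⟨ +-mono-≤ (bound fzero) tail ⟩
  (c fzero + length (g fzero)) + (sumFin (c ∘ fsuc) + length (⋃ (g ∘ fsuc))) ≡⟨ interchange (c fzero) _ _ _ ⟩
  (c fzero + sumFin (c ∘ fsuc)) + (length (g fzero) + length (⋃ (g ∘ fsuc))) ≡⟨ cong (sumFin c +_) (sym (length-++ (g fzero))) ⟩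
  sumFin c + length (g fzero ++ ⋃ (g ∘ fsuc))                                 ∎
  where
  open ≤-Reasoning
  tail : length (⋃ (f ∘ fsuc)) ≤ sumFin (c ∘ fsuc) + length (⋃ (g ∘ fsuc))
  tail = ⋃-length (f ∘ fsuc) (g ∘ fsuc) (c ∘ fsuc) (bound ∘ fsuc)
  interchange : ∀ a b c d → (a + b) + (c + d) ≡ (a + c) + (b + d)
  interchange = solve-∀

Chain-++⁻ˡ : ∀ {n} (G : Graph n) xs {ys} → Chain G (xs ++ ys) → Chain G xs
Chain-++⁻ˡ G []           _       = tt
Chain-++⁻ˡ G (x ∷ [])     _       = tt
Chain-++⁻ˡ G (x ∷ y ∷ xs) (e , c) = e , Chain-++⁻ˡ G (y ∷ xs) c

Chain-∷⁻ : ∀ {n} (G : Graph n) x xs → Chain G (x ∷ xs) → Chain G xs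
Chain-∷⁻ G x []      _       = tt
Chain-∷⁻ G x (_ ∷ _) (_ , c) = c

ind+n≤1+n : ∀ b n → ind b + n ≤ suc n
ind+n≤1+n true  n = ≤-refl
ind+n≤1+n false n = n≤1+n n

module _ {n} (G : Graph n) (inB : Fin n → Bool)
         (independent : ∀ u v → inB u ≡ true → inB v ≡ true → adj G u v ≡ false) where

  #B #A : List (Fin n) → ℕ
  #B xs = length (filterᵇ inB xs)
  #A xs = length (filterᵇ (not ∘ inB) xs)

  walk-B≤ : ∀ x xs → Chain G (x ∷ xs) → #B (x ∷ xs) ≤ ind (inB x) + #A (x ∷ xs)
  walk-B≤ x [] _ with inB x
  ... | true  = ≤-refl
  ... | false = z≤n
  walk-B≤ x (y ∷ ys) (xy , c) with inB x in bx
  ... | false = ≤-trans (walk-B≤ y ys c) (ind+n≤1+n (inB y) _)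
  ... | true with inB y in by | walk-B≤ y ys c
  ...   | true  | _  with () ← trans (sym xy) (independent x y bx by)
  ...   | false | ih = s≤s ih

  walk-B≤1+A : ∀ xs → Chain G xs → #B xs ≤ 1 + #A xs
  walk-B≤1+A []       _ = z≤n
  walk-B≤1+A (x ∷ xs) c = ≤-trans (walk-B≤ x xs c) (ind+n≤1+n (inB x) _)

-- For p : Fin n → Bool
-- marking B, codes p K bounds the number of sets s ⊆ Fin n with countB (p ∧ s) ≤ K:
-- encode sends such a set into Fin (codes p K), injectively, and
-- codes p K ≤ 2 ^ |A| * (|B| + 1) ^ K.

↑ˡ≢↑ʳ : ∀ {m n} (i : Fin m) (j : Fin n) → i ↑ˡ n ≢ m ↑ʳ j
↑ˡ≢↑ʳ {m} {n} i j eq with () ← trans (sym (splitAt-↑ˡ m i n)) (trans (cong (splitAt m) eq) (splitAt-↑ʳ m n j))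

-- Codes after adding one vertex in front of a vertex set counted by M (per budget):
-- an A-vertex (b = false) doubles the count; a B-vertex may only be added to the
-- set if budget remains, and then uses one unit of it.
extend : Bool → (ℕ → ℕ) → ℕ → ℕ
extend false M K       = M K + M K
extend true  M zero    = M zero
extend true  M (suc K) = M (suc K) + M K

-- An encoder of one fixed set using c units of budget: a code for every budget K ≥ c.
Encoder : (ℕ → ℕ) → ℕ → Set
Encoder M c = ∀ K → c ≤ K → Fin (M K)

SameCode : ∀ {M c c'} → Encoder M c → Encoder M c' → Set
SameCode {c = c} {c'} e e' = ∃[ K ] ∃₂ λ (h : c ≤ K) (h' : c' ≤ K) → e K h ≡ e' K h'

-- Put the new vertex (of colour b, in the set iff x) in front: the two halves of
-- Fin (M K + M K') record whether it belongs to the set.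
extendCode : ∀ (M : ℕ → ℕ) {c} → Encoder M c → ∀ b x → Encoder (extend b M) (ind (b ∧ x) + c)
extendCode M e false false K       h       = e K h ↑ˡ M K
extendCode M e false true  K       h       = M K ↑ʳ e K h
extendCode M e true  false zero    h       = e zero h
extendCode M e true  false (suc K) h       = e (suc K) h ↑ˡ M K
extendCode M e true  true  (suc K) (s≤s h) = M (suc K) ↑ʳ e K h

extendCode-injective : ∀ (M : ℕ → ℕ) {c c'} (e : Encoder M c) (e' : Encoder M c') b x x' →
  SameCode (extendCode M e b x) (extendCode M e' b x') → x ≡ x' × SameCode e e'
extendCode-injective M e e' false false false (K , h , h' , eq) = refl , K , h , h' , ↑ˡ-injective (M K) _ _ eq
extendCode-injective M e e' false false true  (K , h , h' , eq) with () ← ↑ˡ≢↑ʳ _ _ eq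
extendCode-injective M e e' false true  false (K , h , h' , eq) with () ← ↑ˡ≢↑ʳ _ _ (sym eq)
extendCode-injective M e e' false true  true  (K , h , h' , eq) = refl , K , h , h' , ↑ʳ-injective (M K) _ _ eq
extendCode-injective M e e' true  false false (zero , h , h' , eq) = refl , zero , h , h' , eq
extendCode-injective M e e' true  false false (suc K , h , h' , eq) = refl , suc K , h , h' , ↑ˡ-injective (M K) _ _ eq
extendCode-injective M e e' true  false true  (suc K , h , s≤s h' , eq) with () ← ↑ˡ≢↑ʳ _ _ eq
extendCode-injective M e e' true  true  false (suc K , s≤s h , h' , eq) with () ← ↑ˡ≢↑ʳ _ _ (sym eq)
extendCode-injective M e e' true  true  true  (suc K , s≤s h , s≤s h' , eq) = refl , K , h , h' , ↑ʳ-injective (M (suc K)) _ _ eq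

codes : ∀ {n} → (Fin n → Bool) → ℕ → ℕ
codes {zero}  p K = 1
codes {suc n} p   = extend (p fzero) (codes (p ∘ fsuc))

encode : ∀ {n} (p s : Fin n → Bool) → Encoder (codes p) (countB (λ v → p v ∧ s v))
encode {zero}  p s K h = fzero
encode {suc n} p s     = extendCode (codes (p ∘ fsuc)) (encode (p ∘ fsuc) (s ∘ fsuc)) (p fzero) (s fzero)

encode-injective : ∀ {n} (p s s' : Fin n → Bool) → SameCode (encode p s) (encode p s') → ∀ v → s v ≡ s' v
encode-injective {suc n} p s s' same v with extendCode-injective (codes (p ∘ fsuc)) _ _ (p fzero) (s fzero) (s' fzero) same
encode-injective {suc n} p s s' same fzero    | head , _    = head
encode-injective {suc n} p s s' same (fsuc v) | _    , tail = encode-injective (p ∘ fsuc) (s ∘ fsuc) (s' ∘ fsuc) tail v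

-- One induction step of the bound: an A-vertex doubles the count, a B-vertex
-- raises the base from c + 1 to c + 2 (Pascal's rule (c+1)^(K+1) + (c+1)^K ≤ (c+2)^(K+1)).
extend-bound : ∀ (M : ℕ → ℕ) b a c → (∀ K → M K ≤ 2 ^ a * (c + 1) ^ K) →
  ∀ K → extend b M K ≤ 2 ^ (ind (not b) + a) * (ind b + c + 1) ^ K
extend-bound M false a c bound K = begin
  M K + M K                                 ≤⟨ +-mono-≤ (bound K) (bound K) ⟩
  2 ^ a * (c + 1) ^ K + 2 ^ a * (c + 1) ^ K ≡⟨ double (2 ^ a) ((c + 1) ^ K) ⟩
  2 * 2 ^ a * (c + 1) ^ K                   ∎
  where
  open ≤-Reasoning
  double : ∀ X Y → X * Y + X * Y ≡ 2 * X * Y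
  double = solve-∀
extend-bound M true a c bound zero    = bound zero
extend-bound M true a c bound (suc K) = begin
  M (suc K) + M K                                       ≤⟨ +-mono-≤ (bound (suc K)) (bound K) ⟩
  2 ^ a * ((c + 1) * (c + 1) ^ K) + 2 ^ a * (c + 1) ^ K ≡⟨ collect (2 ^ a) c ((c + 1) ^ K) ⟩
  2 ^ a * ((suc c + 1) * (c + 1) ^ K)                   ≤⟨ *-monoʳ-≤ (2 ^ a) (*-monoʳ-≤ (suc c + 1) base≤) ⟩
  2 ^ a * (suc c + 1) ^ suc K                           ∎
  where
  open ≤-Reasoning
  collect : ∀ X c Y → X * ((c + 1) * Y) + X * Y ≡ X * ((1 + c + 1) * Y)
  collect = solve-∀
  base≤ : (c + 1) ^ K ≤ (suc c + 1) ^ K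
  base≤ = ^-monoˡ-≤ K (m≤n+m (c + 1) 1)

codes-bound : ∀ {n} (p : Fin n → Bool) K → codes p K ≤ 2 ^ countB (λ v → not (p v)) * (countB p + 1) ^ K
codes-bound {zero}  p K = ≤-reflexive (sym (trans (*-identityˡ (1 ^ K)) (^-zeroˡ K)))
codes-bound {suc n} p   = extend-bound _ (p fzero) _ _ (codes-bound (p ∘ fsuc))

module SubdivisionVertices {n ℓ} (G : Graph n) (inB : Fin n → Bool)
         (independent : ∀ u v → inB u ≡ true → inB v ≡ true → adj G u v ≡ false)
         (F : Graph ℓ) where

  innerOn : Subdivision F G → (Fin n → Bool) → Fin ℓ → Fin ℓ → List (Fin n)
  innerOn H q i j = if isEdge F i j then filterᵇ q (inner H i j) else []

  innerOn-∈ : ∀ (H : Subdivision F G) q {i j v} → v ∈ innerOn H q i j →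
              isEdge F i j ≡ true × v ∈ inner H i j × q v ≡ true
  innerOn-∈ H q {i} {j} m with isEdge F i j
  ... | true = let m' , qv = ∈-filterᵇ⁻ q m in refl , m' , qv

  ∈-innerOn : ∀ (H : Subdivision F G) q {i j v} → isEdge F i j ≡ true → v ∈ inner H i j → q v ≡ true →
              v ∈ innerOn H q i j
  ∈-innerOn H q e m qv rewrite e = ∈-filterᵇ⁺ q m qv

  innerOn-unique : ∀ (H : Subdivision F G) q i j → Unique (innerOn H q i j)
  innerOn-unique H q i j with isEdge F i j in e
  ... | true  = filter⁺ (T? ∘ q) (inner-unique H i j e)
  ... | false = []

  innerOn-disjoint : ∀ (H : Subdivision F G) q {i j i' j'} → ¬ (i ≡ i' × j ≡ j') →
                     Disjoint (innerOn H q i j) (innerOn H q i' j')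
  innerOn-disjoint H q {i} {j} {i'} {j'} different (m , m') =
    let e  , mi  , _ = innerOn-∈ H q m
        e' , mi' , _ = innerOn-∈ H q m'
    in inner-disjoint H i j i' j' e e' different _ mi mi'

  allInner : Subdivision F G → (Fin n → Bool) → List (Fin n)
  allInner H q = ⋃ λ i → ⋃ (innerOn H q i)

  ∈-allInner : ∀ (H : Subdivision F G) q {i j v} → isEdge F i j ≡ true → v ∈ inner H i j → q v ≡ true →
               v ∈ allInner H q
  ∈-allInner H q {i} {j} e m qv = ∈-⋃⁺ (λ i → ⋃ (innerOn H q i)) i (∈-⋃⁺ (innerOn H q i) j (∈-innerOn H q e m qv))

  allInner-∈ : ∀ (H : Subdivision F G) q {v} → v ∈ allInner H q → q v ≡ true
  allInner-∈ H q m =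
    let i , mi = ∈-⋃⁻ (λ i → ⋃ (innerOn H q i)) m
        j , mj = ∈-⋃⁻ (innerOn H q i) mi
    in proj₂ (proj₂ (innerOn-∈ H q mj))

  allInner-unique : ∀ (H : Subdivision F G) q → Unique (allInner H q)
  allInner-unique H q = ⋃-unique (λ i → ⋃ (innerOn H q i))
    (λ i → ⋃-unique (innerOn H q i) (innerOn-unique H q i) (λ j≢j' → innerOn-disjoint H q (j≢j' ∘ proj₂)))
    (λ {i} {i'} i≢i' (m , m') →
      let j  , mj  = ∈-⋃⁻ (innerOn H q i) m
          j' , mj' = ∈-⋃⁻ (innerOn H q i') m'
      in innerOn-disjoint H q (i≢i' ∘ proj₁) (mj , mj'))

  inner-chain : ∀ (H : Subdivision F G) {i j} → isEdge F i j ≡ true → Chain G (inner H i j)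
  inner-chain H {i} {j} e =
    Chain-∷⁻ G (branch H i) (inner H i j) (Chain-++⁻ˡ G (branch H i ∷ inner H i j) {branch H j ∷ []} (isPath H i j e))

  innerOn-length : ∀ (H : Subdivision F G) i j →
                   length (innerOn H inB i j) ≤ ind (isEdge F i j) + length (innerOn H (not ∘ inB) i j)
  innerOn-length H i j with isEdge F i j in e
  ... | true  = walk-B≤1+A G inB independent (inner H i j) (inner-chain H {i} {j} e)
  ... | false = z≤n

  allInner-length : ∀ (H : Subdivision F G) → length (allInner H inB) ≤ edges F + length (allInner H (not ∘ inB))
  allInner-length H = ⋃-length (innerFrom inB) (innerFrom (not ∘ inB)) (countB ∘ isEdge F) λ i →
    subst (λ k → length (innerFrom inB i) ≤ k + length (innerFrom (not ∘ inB) i))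
          (sym (countB-as-sum (isEdge F i)))
          (⋃-length (innerOn H inB i) (innerOn H (not ∘ inB) i) (ind ∘ isEdge F i) (innerOn-length H i))
    where
    innerFrom : (Fin n → Bool) → Fin ℓ → List (Fin n)
    innerFrom q i = ⋃ (innerOn H q i)

  -- The inner A-vertices are distinct A-vertices, so there are at most |A| of them.
  allInner-A : ∀ (H : Subdivision F G) → length (allInner H (not ∘ inB)) ≤ countB (λ v → not (inB v))
  allInner-A H = length≤countB _ _ (allInner-unique H _) (allInner-∈ H _)

  vertex? : ∀ (H : Subdivision F G) v → Dec (v ∈V H)
  vertex? H v = any? (λ k → branch H k ≟ᶠ v)
         ⊎-dec any? (λ i → any? (λ j → (isEdge F i j ≟ᵇ true) ×-dec member? _≟ᶠ_ v (inner H i j)))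

  χ : Subdivision F G → Fin n → Bool
  χ H v = does (vertex? H v)

  χ-sound : ∀ (H : Subdivision F G) {v} → χ H v ≡ true → v ∈V H
  χ-sound H {v} = does-true (vertex? H v)

  same-χ⇒same-vertices : ∀ (H H' : Subdivision F G) → (∀ v → χ H v ≡ χ H' v) →
                          ∀ v → (v ∈V H → v ∈V H') × (v ∈V H' → v ∈V H)
  same-χ⇒same-vertices H H' same v =
      (λ v∈H  → χ-sound H' {v} (trans (sym (same v)) (dec-true (vertex? H v) v∈H)))
    , (λ v∈H' → χ-sound H  {v} (trans (same v) (dec-true (vertex? H' v) v∈H')))

  B-cover : Subdivision F G → List (Fin n)
  B-cover H = map (branch H) (allFin ℓ) ++ allInner H inB

  B-cover-complete : ∀ (H : Subdivision F G) {v} → inB v ∧ χ H v ≡ true → v ∈ B-cover H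
  B-cover-complete H {v} h with ∧-true {inB v} h
  ... | v∈B , χv with χ-sound H {v} χv
  ... | inj₁ (k , refl)         = ∈-++⁺ˡ (∈-map⁺ (branch H) (∈-allFin k))
  ... | inj₂ (i , j , e , v∈ij) = ∈-++⁺ʳ (map (branch H) (allFin ℓ)) (∈-allInner H inB e v∈ij v∈B)

  length-B-cover : ∀ (H : Subdivision F G) → length (B-cover H) ≤ ℓ + (edges F + countB (λ v → not (inB v)))
  length-B-cover H = begin
    length (B-cover H)                                      ≡⟨ length-++ (map (branch H) (allFin ℓ)) ⟩
    length (map (branch H) (allFin ℓ)) + length (allInner H inB)
      ≡⟨ cong (_+ length (allInner H inB)) (trans (length-map (branch H) (allFin ℓ)) (length-tabulate _)) ⟩
    ℓ + length (allInner H inB)                             ≤⟨ +-monoʳ-≤ ℓ (allInner-length H) ⟩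
    ℓ + (edges F + length (allInner H (not ∘ inB)))         ≤⟨ +-monoʳ-≤ ℓ (+-monoʳ-≤ (edges F) (allInner-A H)) ⟩
    ℓ + (edges F + countB (λ v → not (inB v)))              ∎
    where open ≤-Reasoning

  B-vertices : ∀ (H : Subdivision F G) → countB (λ v → not (inB v)) ≤ ℓ →
               countB (λ v → inB v ∧ χ H v) ≤ edges F + 2 * ℓ
  B-vertices H |A|≤ℓ = begin
    countB (λ v → inB v ∧ χ H v)  ≤⟨ countB≤length _ (B-cover H) (B-cover-complete H) ⟩
    length (B-cover H)             ≤⟨ length-B-cover H ⟩
    ℓ + (edges F + countB (λ v → not (inB v))) ≤⟨ +-monoʳ-≤ ℓ (+-monoʳ-≤ (edges F) |A|≤ℓ) ⟩
    ℓ + (edges F + ℓ)              ≡⟨ rearrange ℓ (edges F) ⟩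
    edges F + 2 * ℓ                ∎
    where
    open ≤-Reasoning
    rearrange : ∀ l e → l + (e + l) ≡ e + 2 * l
    rearrange = solve-∀

lemma4 : ∀ {n ℓ : ℕ} (G : Graph n) (inB : Fin n → Bool) →
    (∀ u v → inB u ≡ true → inB v ≡ true → adj G u v ≡ false) →
    (F : Graph ℓ) → countB (λ v → not (inB v)) ≤ ℓ →
    (m : ℕ) (H : Fin m → Subdivision F G) →
    (∀ a b → a ≢ b → Distinguishable (H a) (H b)) →
    m ≤ 2 ^ ℓ * (countB inB + 1) ^ (edges F + 2 * ℓ)
lemma4 {ℓ = ℓ} G inB independent F |A|≤ℓ m H distinguishable = begin
  m                                                     ≤⟨ injective⇒≤ code-injective ⟩
  codes inB K                                           ≤⟨ codes-bound inB K ⟩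
  2 ^ countB (λ v → not (inB v)) * (countB inB + 1) ^ K ≤⟨ *-monoˡ-≤ _ (^-monoʳ-≤ 2 |A|≤ℓ) ⟩
  2 ^ ℓ * (countB inB + 1) ^ K                          ∎
  where
  open ≤-Reasoning
  open SubdivisionVertices G inB independent F
  K : ℕ
  K = edges F + 2 * ℓ
  code : Fin m → Fin (codes inB K)
  code a = encode inB (χ (H a)) K (B-vertices (H a) |A|≤ℓ)
  code-injective : ∀ {a b} → code a ≡ code b → a ≡ b
  code-injective {a} {b} eq = decidable-stable (a ≟ᶠ b) λ a≢b →
    distinguishable a b a≢b (same-χ⇒same-vertices (H a) (H b) (encode-injective inB _ _ (K , _ , _ , eq)))
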